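{- For every integer $n \geq 1$, there is exactly one rooted binary tree (up to isomorphism) with $n$ leaves whose stairs2 index is maximum among all rooted binary trees with $n$ leaves, namely the binary echelon tree $BE_n$.
   Context: A rooted tree is a directed graph with exactly one vertex of in-degree zero (the root $\rho$) such that every vertex is reached from $\rho$ by a unique directed path, and no vertex has out-degree one; leaves are vertices of out-degree zero, inner vertices are the others. It is binary if every inner vertex has out-degree two. Trees are considered up to isomorphism; for $n=1$ the tree is a single vertex, and for $n=0$ it is the empty graph. For a vertex $v$, $n_v$ denotes the number of leaves of the subtree pending at $v$ (consisting of $v$ and all its descendants). A tree $T$ with $n\ge 2$ leaves is written $T=(T_1,T_2)$, where $T_1,T_2$ are the subtrees pending at the two children of the root. All logarithms are base $2$. The stairs2 index of a rooted binary tree $T$ with $n$ leaves is $st_2(T)=0$ if $n\in\{0,1\}$, and for $n \ge 2$ $$st_2(T)=\frac{1}{n-1}\sum_{v \text{ inner vertex of } T}\frac{\min\{n_{v_1},n_{v_2}\}}{\max\{n_{v_1},n_{v_2}\}},$$ where $v_1,v_2$ are the two children of $v$. The fully balanced tree $T^{fb}_h$ of height $h\ge 0$ is the unique rooted binary tree with $2^h$ leaves all at depth $h$ (distance $h$ from the root). The binary echelon tree $BE_n$ is defined recursively: $BE_0$ is the empty tree, $BE_1$ is a single vertex, and for $n\ge 2$, letting $k$ be the unique power of two with $n/2 \le k < n$, $BE_n=(T^{fb}_{\log k}, BE_{n-k})$, i.e. the root has as its two pending subtrees a fully balanced tree with $k$ leaves and a binary echelon tree with $n-k$ leaves (when $n-k=0$...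 note $n-k\ge 1$ here since $k<n$). -}

module Defs where

open import Data.Nat using (ℕ; zero; suc; _+_; _∸_; _^_; _⊓_; _⊔_)
open import Data.Nat.Logarithm using (⌊log₂_⌋)
open import Data.Integer using (+_)
open import Data.Rational using (ℚ; 0ℚ; _/_) renaming (_+_ to _+ℚ_; _*_ to _*ℚ_)
open import Data.Product using (_×_)
open import Data.Sum using (_⊎_)

-- Rooted binary trees with n ≥ 1 leaves (shape only; children unordered via _≅_).
data Tree : Set where
  leaf : Tree
  node : Tree → Tree → Tree

data _≅_ : Tree → Tree → Set where
  leaf≅  : leaf ≅ leaf
  node≅  : ∀ {a b c d} → a ≅ c → b ≅ d → node a b ≅ node c d
  swap≅  : ∀ {a b c d} → a ≅ d → b ≅ c → node a b ≅ node c d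

leaves : Tree → ℕ
leaves leaf       = 1
leaves (node a b) = leaves a + leaves b

ratio : ℕ → ℕ → ℚ
ratio zero    _       = 0ℚ
ratio (suc _) zero    = 0ℚ
ratio (suc a) (suc b) = (+ (suc a ⊓ suc b)) / (suc a ⊔ suc b)

stairSum : Tree → ℚ
stairSum leaf       = 0ℚ
stairSum (node a b) = ratio (leaves a) (leaves b) +ℚ (stairSum a +ℚ stairSum b)

st2 : Tree → ℚ
st2 t with leaves t
... | zero        = 0ℚ
... | suc zero    = 0ℚ
... | suc (suc m) = ((+ 1) / suc m) *ℚ stairSum t

fb : ℕ → Tree
fb zero    = leaf
fb (suc h) = node (fb h) (fb h)

-- for n ≥ 2: the unique power of two k with n/2 ≤ k < n, k = 2^⌊log₂(n-1)⌋
echelonK : ℕ → ℕ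
echelonK n = 2 ^ ⌊log₂ (n ∸ 1) ⌋

-- binary echelon tree, by recursion with fuel (fuel n suffices since n-k < n)
beFuel : ℕ → ℕ → Tree
beFuel zero       n             = leaf
beFuel (suc fuel) zero          = leaf
beFuel (suc fuel) (suc zero)    = leaf
beFuel (suc fuel) (suc (suc m)) =
  node (fb ⌊log₂ (suc m) ⌋) (beFuel fuel (suc (suc m) ∸ echelonK (suc (suc m))))

-- BE_n for n ≥ 1 (the value at n = 0 is irrelevant and never used)
BE : ℕ → Tree
BE n = beFuel n n

{-# OPTIONS --safe #-}
-- It suffices to show that every tree T with n leaves satisfies stairSum T < stairSum (BE n) or
-- T ≅ BE n, because st2 is the stairs sum scaled by 1 / (n - 1). By induction on T this reduces to
-- joins: node (BE a) (BE b) must have a smaller stairs sum than BE (a + b) or be isomorphic to it.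
-- Let a ≤ b = 2^h + s with s < 2^h. If s = 0, the join is BE (a + b) with its children swapped.
-- Otherwise unfold BE b = node (fb h) (BE s), and also BE a = node (fb h) (BE t) when a = 2^h + t.
-- One local rearrangement of these subtrees (a swap, a rotation, an interchange of grandchildren,
-- or a swap followed by a rotation) turns the join into BE (a + b), except that a smaller join
-- node (BE a) (BE s) or node (BE t) (BE s) may stand where BE (a + s) or BE (t + s) belongs; by
-- induction, putting the echelon tree there does not lower the stairs sum. A rearrangement only
-- changes the ratios min/max at the vertices it moves, and elementary inequalities between fractions
-- show that their sum strictly increases.
module Submission where

open import Defs

module Echelon where

  open import Algebra.Bundles using (CommutativeMonoid)
  import Algebra.Properties.CommutativeSemigroup as CommutativeSemigroupProperties
  open import Data.Integer as ℤ using (ℤ; +_)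
  import Data.Integer.Properties as ℤ
  open import Data.Integer.Tactic.RingSolver using () renaming (ring to ℤ-ring)
  open import Data.List using ([]; _∷_)
  open import Data.Maybe using (nothing)
  open import Data.Nat
  open import Data.Nat.Induction using (Acc; acc; <-wellFounded)
  open import Data.Nat.Logarithm using (⌊log₂_⌋; ⌊log₂⌋-mono-≤; ⌊log₂[2^n]⌋≡n; ⌊log₂⌊n/2⌋⌋≡⌊log₂n⌋∸1)
  open import Data.Nat.Properties
  open import Data.Nat.Tactic.RingSolver using (solve)
  open import Data.Product using (_,_)
  open import Data.Rational as ℚ using (ℚ; 0ℚ; toℚᵘ)
  import Data.Rational.Properties as ℚ
  open import Data.Rational.Unnormalised as ℚᵘ using (mkℚᵘ; *≡*; *≤*; *<*)
  import Data.Rational.Unnormalised.Properties as ℚᵘ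
  open import Data.Sum using (_⊎_; inj₁; inj₂)
  open import Function using (_∘_)
  open import Function.Bundles using (_⇔_; mk⇔; Equivalence)
  open import Level using (0ℓ)
  open import Relation.Binary.Definitions using (tri<; tri≈; tri>)
  open import Relation.Binary.PropositionalEquality
  open import Relation.Nullary using (yes; no; contradiction)
  open import Tactic.RingSolver using (solve-∀)
  open import Tactic.RingSolver.Core.AlmostCommutativeRing using (AlmostCommutativeRing; fromCommutativeRing)

  open CommutativeSemigroupProperties (CommutativeMonoid.commutativeSemigroup ℚ.+-0-commutativeMonoid)
    using (interchange; x∙yz≈xz∙y; xy∙z≈xz∙y; xy∙z≈y∙xz; xy∙z≈zx∙y)
  module ℕ+ = CommutativeSemigroupProperties +-commutativeSemigroup

  ratio-comm : ∀ a b → ratio a b ≡ ratio b a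
  ratio-comm zero    zero    = refl
  ratio-comm zero    (suc b) = refl
  ratio-comm (suc a) zero    = refl
  ratio-comm (suc a) (suc b) rewrite ⊓-comm a b | ⊔-comm a b = refl

  ratio-nonneg : ∀ a b → 0ℚ ℚ.≤ ratio a b
  ratio-nonneg zero    b       = ℚ.≤-refl
  ratio-nonneg (suc a) zero    = ℚ.≤-refl
  ratio-nonneg (suc a) (suc b) = ℚ.nonNegative⁻¹ _ {{ℚ.normalize-nonNeg (suc (a ⊓ b)) (suc (a ⊔ b))}}

  toℚᵘ-ratio : ∀ {a b} → a ≤ suc b → toℚᵘ (ratio a (suc b)) ℚᵘ.≃ mkℚᵘ (+ a) b
  toℚᵘ-ratio {zero}      _         = *≡* refl
  toℚᵘ-ratio {suc a} {b} (s≤s a≤b) rewrite m≤n⇒m⊓n≡m a≤b | m≤n⇒m⊔n≡n a≤b =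
    ℚ.toℚᵘ-fromℚᵘ (mkℚᵘ (+ suc a) b)

  ratio-≤-cross : ∀ {a b c d} → a ≤ suc b → c ≤ suc d → a * suc d ≤ c * suc b →
                  ratio a (suc b) ℚ.≤ ratio c (suc d)
  ratio-≤-cross {a} {b} {c} {d} a≤b c≤d ad≤cb =
    ℚ.toℚᵘ-cancel-≤ (ℚᵘ.≤-respˡ-≃ (ℚᵘ.≃-sym (toℚᵘ-ratio a≤b)) (ℚᵘ.≤-respʳ-≃ (ℚᵘ.≃-sym (toℚᵘ-ratio c≤d))
      (*≤* (subst₂ ℤ._≤_ (ℤ.pos-* a (suc d)) (ℤ.pos-* c (suc b)) (ℤ.+≤+ ad≤cb)))))

  ratio-<-cross : ∀ {a b c d} → a ≤ suc b → c ≤ suc d → a * suc d < c * suc b →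
                  ratio a (suc b) ℚ.< ratio c (suc d)
  ratio-<-cross {a} {b} {c} {d} a≤b c≤d ad<cb =
    ℚ.toℚᵘ-cancel-< (ℚᵘ.<-respˡ-≃ (ℚᵘ.≃-sym (toℚᵘ-ratio a≤b)) (ℚᵘ.<-respʳ-≃ (ℚᵘ.≃-sym (toℚᵘ-ratio c≤d))
      (*<* (subst₂ ℤ._<_ (ℤ.pos-* a (suc d)) (ℤ.pos-* c (suc b)) (ℤ.+<+ ad<cb)))))

  ratio-≡-cross : ∀ {a b c d} → a ≤ suc b → c ≤ suc d → a * suc d ≡ c * suc b →
                  ratio a (suc b) ≡ ratio c (suc d)
  ratio-≡-cross a≤b c≤d ad≡cb =
    ℚ.≤-antisym (ratio-≤-cross a≤b c≤d (≤-reflexive ad≡cb)) (ratio-≤-cross c≤d a≤b (≤-reflexive (sym ad≡cb)))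

  ratio-+ : ∀ a c {b} → a + c ≤ b → ratio a b ℚ.+ ratio c b ≡ ratio (a + c) b
  ratio-+ zero zero {zero} _ = refl
  ratio-+ a c {suc b} a+c≤b = ℚ.toℚᵘ-injective (begin
    toℚᵘ (ratio a (suc b) ℚ.+ ratio c (suc b))         ≈⟨ ℚ.toℚᵘ-homo-+ (ratio a (suc b)) (ratio c (suc b)) ⟩
    toℚᵘ (ratio a (suc b)) ℚᵘ.+ toℚᵘ (ratio c (suc b)) ≈⟨ ℚᵘ.+-cong (toℚᵘ-ratio (≤-trans (m≤m+n a c) a+c≤b))
                                                                  (toℚᵘ-ratio (≤-trans (m≤n+m c a) a+c≤b)) ⟩
    mkℚᵘ (+ a) b ℚᵘ.+ mkℚᵘ (+ c) b                    ≈⟨ *≡* (trans (same-denominator (+ a) (+ c) (+ suc b))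
                                                             (cong (+ (a + c) ℤ.*_) (sym (ℤ.pos-* (suc b) (suc b))))) ⟩
    mkℚᵘ (+ (a + c)) b                                ≈⟨ ℚᵘ.≃-sym (toℚᵘ-ratio a+c≤b) ⟩
    toℚᵘ (ratio (a + c) (suc b))                      ∎)
    where
    open ℚᵘ.≃-Reasoning
    same-denominator : ∀ (x y d : ℤ) → (x ℤ.* d ℤ.+ y ℤ.* d) ℤ.* d ≡ (x ℤ.+ y) ℤ.* (d ℤ.* d)
    same-denominator = solve-∀ ℤ-ring

  ratio-self : ∀ {m n} → 0 < m → 0 < n → ratio m m ≡ ratio n n
  ratio-self {suc m} {suc n} _ _ = ratio-≡-cross {b = m} {d = n} ≤-refl ≤-refl (*-comm (suc m) (suc n))

  ratio-double : ∀ {a b} → a ≤ b → ratio (a + a) (b + b) ≡ ratio a b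
  ratio-double {b = zero}  z≤n = refl
  ratio-double {a} {suc b} a≤b = ratio-≡-cross (+-mono-≤ a≤b a≤b) a≤b (solve (a ∷ b ∷ []))

  ratio-half : ∀ {a b} → a ≤ b → ratio a b ≡ ratio a (b + b) ℚ.+ ratio a (b + b)
  ratio-half {a} a≤b = sym (trans (ratio-+ a a (+-mono-≤ a≤b a≤b)) (ratio-double a≤b))

  ratio-monoˡ-≤ : ∀ {a c b} → a ≤ c → c ≤ b → ratio a b ℚ.≤ ratio c b
  ratio-monoˡ-≤ {b = zero}  z≤n z≤n = ℚ.≤-refl
  ratio-monoˡ-≤ {b = suc b} a≤c c≤b = ratio-≤-cross (≤-trans a≤c c≤b) c≤b (*-monoˡ-≤ (suc b) a≤c)

  ratio-monoˡ-< : ∀ {a c b} → a < c → c ≤ b → ratio a b ℚ.< ratio c b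
  ratio-monoˡ-< {b = suc b} a<c c≤b@(s≤s _) =
    ratio-<-cross (≤-trans (<⇒≤ a<c) c≤b) c≤b (*-monoˡ-< (suc b) a<c)

  ratio-antimonoʳ-≤ : ∀ {a b c} → a ≤ b → b ≤ c → ratio a c ℚ.≤ ratio a b
  ratio-antimonoʳ-≤ {b = zero}  z≤n _             = ℚ.≤-refl
  ratio-antimonoʳ-≤ {a} {suc b} a≤b b≤c@(s≤s _) = ratio-≤-cross (≤-trans a≤b b≤c) a≤b (*-monoʳ-≤ a b≤c)

  ratio-antimonoʳ-< : ∀ {a b c} → 0 < a → a ≤ b → b < c → ratio a c ℚ.< ratio a b
  ratio-antimonoʳ-< {suc a} {suc b} {suc c} _ a≤b b<c =
    ratio-<-cross (≤-trans a≤b (<⇒≤ b<c)) a≤b (*-monoʳ-< (suc a) b<c)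

  -- Ratio inequalities behind the four rearrangements

  ratio-swap-< : ∀ {a s K} → 0 < a → 0 < s → a + s ≤ K →
                 ratio a (K + s) ℚ.+ ratio K s ℚ.< ratio K (a + s) ℚ.+ ratio a s
  ratio-swap-< {a} {s} {K} 0<a 0<s a+s≤K = begin-strict
    ratio a (K + s) ℚ.+ ratio K s  <⟨ ℚ.+-monoˡ-< (ratio K s) (ratio-antimonoʳ-< 0<a a≤K (m<m+n K 0<s)) ⟩
    ratio a K ℚ.+ ratio K s        ≡⟨ cong (ratio a K ℚ.+_) (ratio-comm K s) ⟩
    ratio a K ℚ.+ ratio s K        ≡⟨ ratio-+ a s a+s≤K ⟩
    ratio (a + s) K                ≡⟨ ratio-comm (a + s) K ⟩
    ratio K (a + s)                ≡⟨ sym (ℚ.+-identityʳ (ratio K (a + s))) ⟩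
    ratio K (a + s) ℚ.+ 0ℚ         ≤⟨ ℚ.+-monoʳ-≤ (ratio K (a + s)) (ratio-nonneg a s) ⟩
    ratio K (a + s) ℚ.+ ratio a s  ∎
    where
    open ℚ.≤-Reasoning
    a≤K : a ≤ K
    a≤K = ≤-trans (m≤m+n a s) a+s≤K

  ratio-assoc-< : ∀ {H s} → 0 < s → s < H →
                  ratio H (H + s) ℚ.+ ratio H s ℚ.< ratio (H + H) s ℚ.+ ratio H H
  ratio-assoc-< {H} {s} 0<s s<H = begin-strict
    x ℚ.+ ratio H s                           ≡⟨ cong (x ℚ.+_) (trans (ratio-comm H s) (ratio-half (<⇒≤ s<H))) ⟩
    x ℚ.+ (y ℚ.+ y)                           <⟨ ℚ.+-monoʳ-< x (ℚ.+-monoˡ-< y y<z) ⟩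
    x ℚ.+ (z ℚ.+ y)                           ≡⟨ sym (ℚ.+-assoc x z y) ⟩
    x ℚ.+ z ℚ.+ y                             ≡⟨ cong₂ ℚ._+_ (ratio-+ H s ≤-refl) (ratio-comm s (H + H)) ⟩
    ratio (H + s) (H + s) ℚ.+ ratio (H + H) s ≡⟨ ℚ.+-comm (ratio (H + s) (H + s)) (ratio (H + H) s) ⟩
    ratio (H + H) s ℚ.+ ratio (H + s) (H + s) ≡⟨ cong (ratio (H + H) s ℚ.+_) (ratio-self 0<H+s 0<H) ⟩
    ratio (H + H) s ℚ.+ ratio H H             ∎
    where
    open ℚ.≤-Reasoning
    x = ratio H (H + s)
    y = ratio s (H + H)
    z = ratio s (H + s)
    y<z : y ℚ.< z
    y<z = ratio-antimonoʳ-< 0<s (m≤n+m s H) (+-monoʳ-< H s<H)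
    0<H : 0 < H
    0<H = <-trans 0<s s<H
    0<H+s : 0 < H + s
    0<H+s = <-≤-trans 0<H (m≤m+n H s)

  ratio-interchange-< : ∀ {H t s} → 0 < t → t ≤ s → s < H →
    ratio (H + t) (H + s) ℚ.+ (ratio H t ℚ.+ ratio H s) ℚ.< ratio (H + H) (t + s) ℚ.+ (ratio H H ℚ.+ ratio t s)
  ratio-interchange-< {H} {t} 0<t t≤s s<H with m≤n⇒∃[o]m+o≡n t≤s
  ... | q , refl = begin-strict
    x ℚ.+ (ratio H t ℚ.+ ratio H s)  ≡⟨ cong (x ℚ.+_) halves ⟩
    x ℚ.+ (X ℚ.+ X)                  ≡⟨ sym (ℚ.+-assoc x X X) ⟩
    x ℚ.+ X ℚ.+ X                    <⟨ ℚ.+-monoˡ-< X core ⟩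
    R ℚ.+ X                          ≡⟨ ℚ.+-comm R X ⟩
    X ℚ.+ R                          ≡⟨ cong (ℚ._+ R) (ratio-comm (t + s) (H + H)) ⟩
    ratio (H + H) (t + s) ℚ.+ R      ∎
    where
    open ℚ.≤-Reasoning
    s = t + q
    x = ratio (H + t) (H + s)
    X = ratio (t + s) (H + H)
    R = ratio H H ℚ.+ ratio t s
    s≤H : s ≤ H
    s≤H = <⇒≤ s<H
    t≤H : t ≤ H
    t≤H = ≤-trans t≤s s≤H
    t+s≤H+H : t + s ≤ H + H
    t+s≤H+H = +-mono-≤ t≤H s≤H
    0<H : 0 < H
    0<H = <-≤-trans 0<t t≤H
    halves : ratio H t ℚ.+ ratio H s ≡ X ℚ.+ X
    halves = begin-equality
      ratio H t ℚ.+ ratio H s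
        ≡⟨ cong₂ ℚ._+_ (trans (ratio-comm H t) (ratio-half t≤H)) (trans (ratio-comm H s) (ratio-half s≤H)) ⟩
      (ratio t (H + H) ℚ.+ ratio t (H + H)) ℚ.+ (ratio s (H + H) ℚ.+ ratio s (H + H))
        ≡⟨ interchange (ratio t (H + H)) (ratio t (H + H)) (ratio s (H + H)) (ratio s (H + H)) ⟩
      (ratio t (H + H) ℚ.+ ratio s (H + H)) ℚ.+ (ratio t (H + H) ℚ.+ ratio s (H + H))
        ≡⟨ cong₂ ℚ._+_ (ratio-+ t s t+s≤H+H) (ratio-+ t s t+s≤H+H) ⟩
      X ℚ.+ X ∎
    core : x ℚ.+ X ℚ.< R
    core = begin-strict
      x ℚ.+ X
        ≡⟨ cong (λ n → x ℚ.+ ratio n (H + H)) (sym (+-assoc t t q)) ⟩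
      x ℚ.+ ratio (t + t + q) (H + H)
        ≡⟨ cong (x ℚ.+_) (sym (ratio-+ (t + t) q (≤-trans (≤-reflexive (+-assoc t t q)) t+s≤H+H))) ⟩
      x ℚ.+ (ratio (t + t) (H + H) ℚ.+ ratio q (H + H))
        ≤⟨ ℚ.+-monoʳ-≤ x (ℚ.+-monoʳ-≤ (ratio (t + t) (H + H))
                            (ratio-antimonoʳ-≤ (≤-trans (m≤n+m q t) (m≤n+m s H)) (+-monoʳ-≤ H s≤H))) ⟩
      x ℚ.+ (ratio (t + t) (H + H) ℚ.+ ratio q (H + s))
        ≡⟨ x∙yz≈xz∙y x (ratio (t + t) (H + H)) (ratio q (H + s)) ⟩
      x ℚ.+ ratio q (H + s) ℚ.+ ratio (t + t) (H + H)
        ≡⟨ cong₂ ℚ._+_ (trans (ratio-+ (H + t) q (≤-reflexive (+-assoc H t q)))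
                              (cong (λ n → ratio n (H + s)) (+-assoc H t q)))
                       (ratio-double t≤H) ⟩
      ratio (H + s) (H + s) ℚ.+ ratio t H
        <⟨ ℚ.+-mono-≤-< (ℚ.≤-reflexive (ratio-self (<-≤-trans 0<H (m≤m+n H s)) 0<H)) (ratio-antimonoʳ-< 0<t t≤s s<H) ⟩
      ratio H H ℚ.+ ratio t s ∎

  ratio-exchange-< : ∀ {H a s r} → 0 < a → a < H → s < H → a + s ≡ H + r →
    ratio a (H + s) ℚ.+ ratio H s ℚ.+ ratio H r ℚ.< ratio (H + H) r ℚ.+ ratio H H ℚ.+ ratio a s
  ratio-exchange-< {H} {a} {s} {r} 0<a a<H s<H a+s≡H+r = begin-strict
    P ℚ.+ ratio H r                             ≡⟨ cong (P ℚ.+_) (trans (ratio-comm H r) (ratio-half r≤H)) ⟩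
    P ℚ.+ (Y ℚ.+ Y)                             ≡⟨ sym (ℚ.+-assoc P Y Y) ⟩
    P ℚ.+ Y ℚ.+ Y                               <⟨ ℚ.+-monoˡ-< Y core ⟩
    ratio H H ℚ.+ ratio a s ℚ.+ Y               ≡⟨ xy∙z≈zx∙y (ratio H H) (ratio a s) Y ⟩
    Y ℚ.+ ratio H H ℚ.+ ratio a s               ≡⟨ cong (λ y → y ℚ.+ ratio H H ℚ.+ ratio a s) (ratio-comm r (H + H)) ⟩
    ratio (H + H) r ℚ.+ ratio H H ℚ.+ ratio a s ∎
    where
    open ℚ.≤-Reasoning
    P = ratio a (H + s) ℚ.+ ratio H s
    Y = ratio r (H + H)
    s≤H : s ≤ H
    s≤H = <⇒≤ s<H
    0<H : 0 < H
    0<H = <-trans 0<a a<H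
    0<H+s : 0 < H + s
    0<H+s = <-≤-trans 0<H (m≤m+n H s)
    r<a : r < a
    r<a = +-cancelˡ-< H r a (subst₂ _<_ a+s≡H+r (+-comm a H) (+-monoʳ-< a s<H))
    r<s : r < s
    r<s = +-cancelˡ-< H r s (subst (_< H + s) a+s≡H+r (+-monoˡ-< s a<H))
    r≤H : r ≤ H
    r≤H = <⇒≤ (<-trans r<a a<H)
    core : P ℚ.+ Y ℚ.< ratio H H ℚ.+ ratio a s
    core with ≤-total a s
    ... | inj₁ a≤s = begin-strict
      ratio a (H + s) ℚ.+ ratio H s ℚ.+ Y                 <⟨ ℚ.+-mono-<-≤ (ℚ.+-mono-≤-< aHs≤as2 Hs<HH) Y≤as2 ⟩
      ratio a (s + s) ℚ.+ ratio H H ℚ.+ ratio a (s + s)   ≡⟨ xy∙z≈y∙xz (ratio a (s + s)) (ratio H H) (ratio a (s + s)) ⟩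
      ratio H H ℚ.+ (ratio a (s + s) ℚ.+ ratio a (s + s)) ≡⟨ cong (ratio H H ℚ.+_) (sym (ratio-half a≤s)) ⟩
      ratio H H ℚ.+ ratio a s                             ∎
      where
      a≤s+s : a ≤ s + s
      a≤s+s = ≤-trans a≤s (m≤m+n s s)
      aHs≤as2 : ratio a (H + s) ℚ.≤ ratio a (s + s)
      aHs≤as2 = ratio-antimonoʳ-≤ a≤s+s (+-monoˡ-≤ s s≤H)
      Hs<HH : ratio H s ℚ.< ratio H H
      Hs<HH = subst (ℚ._< ratio H H) (ratio-comm s H) (ratio-monoˡ-< s<H ≤-refl)
      Y≤as2 : Y ℚ.≤ ratio a (s + s)
      Y≤as2 = ℚ.≤-trans (ratio-monoˡ-≤ (<⇒≤ r<a) (≤-trans a≤s+s (+-mono-≤ s≤H s≤H)))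
                        (ratio-antimonoʳ-≤ a≤s+s (+-mono-≤ s≤H s≤H))
    ... | inj₂ s≤a = begin-strict
      ratio a (H + s) ℚ.+ ratio H s ℚ.+ Y                 <⟨ ℚ.+-mono-≤-< (ℚ.+-mono-≤ aHs≤HHs Hs≤sa) Y<sHs ⟩
      ratio H (H + s) ℚ.+ ratio s a ℚ.+ ratio s (H + s)   ≡⟨ xy∙z≈xz∙y (ratio H (H + s)) (ratio s a) (ratio s (H + s)) ⟩
      ratio H (H + s) ℚ.+ ratio s (H + s) ℚ.+ ratio s a   ≡⟨ cong₂ ℚ._+_ (trans (ratio-+ H s ≤-refl) (ratio-self 0<H+s 0<H))
                                                                         (ratio-comm s a) ⟩
      ratio H H ℚ.+ ratio a s                             ∎
      where
      aHs≤HHs : ratio a (H + s) ℚ.≤ ratio H (H + s)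
      aHs≤HHs = ratio-monoˡ-≤ (<⇒≤ a<H) (m≤m+n H s)
      Hs≤sa : ratio H s ℚ.≤ ratio s a
      Hs≤sa = subst (ℚ._≤ ratio s a) (ratio-comm s H) (ratio-antimonoʳ-≤ s≤a (<⇒≤ a<H))
      Y<sHs : Y ℚ.< ratio s (H + s)
      Y<sHs = ℚ.<-≤-trans (ratio-monoˡ-< r<s (≤-trans s≤H (m≤m+n H H)))
                          (ratio-antimonoʳ-≤ (m≤n+m s H) (+-monoʳ-≤ H s≤H))

  leaves-pos : ∀ T → 0 < leaves T
  leaves-pos leaf       = s≤s z≤n
  leaves-pos (node A B) = <-≤-trans (leaves-pos A) (m≤m+n (leaves A) (leaves B))

  leaves-one : ∀ {T} → leaves T ≡ 1 → T ≡ leaf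
  leaves-one {leaf}     _ = refl
  leaves-one {node A B} e = contradiction e (>⇒≢ (+-mono-≤ (leaves-pos A) (leaves-pos B)))

  ≅-refl : ∀ {T} → T ≅ T
  ≅-refl {leaf}     = leaf≅
  ≅-refl {node A B} = node≅ ≅-refl ≅-refl

  ≅-reflexive : ∀ {T U} → T ≡ U → T ≅ U
  ≅-reflexive refl = ≅-refl

  ≅-trans : ∀ {T U V} → T ≅ U → U ≅ V → T ≅ V
  ≅-trans leaf≅       q             = q
  ≅-trans (node≅ p q) (node≅ p′ q′) = node≅ (≅-trans p p′) (≅-trans q q′)
  ≅-trans (node≅ p q) (swap≅ p′ q′) = swap≅ (≅-trans p p′) (≅-trans q q′)
  ≅-trans (swap≅ p q) (node≅ p′ q′) = swap≅ (≅-trans p q′) (≅-trans q p′)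
  ≅-trans (swap≅ p q) (swap≅ p′ q′) = node≅ (≅-trans p q′) (≅-trans q p′)

  ≅-leaves : ∀ {T U} → T ≅ U → leaves T ≡ leaves U
  ≅-leaves leaf≅                        = refl
  ≅-leaves (node≅ p q)                  = cong₂ _+_ (≅-leaves p) (≅-leaves q)
  ≅-leaves (swap≅ {c = C} {d = D} p q) = trans (cong₂ _+_ (≅-leaves p) (≅-leaves q)) (+-comm (leaves D) (leaves C))

  ≅-stairSum : ∀ {T U} → T ≅ U → stairSum T ≡ stairSum U
  ≅-stairSum leaf≅       = refl
  ≅-stairSum (node≅ p q) =
    cong₂ ℚ._+_ (cong₂ ratio (≅-leaves p) (≅-leaves q)) (cong₂ ℚ._+_ (≅-stairSum p) (≅-stairSum q))
  ≅-stairSum (swap≅ {c = C} {d = D} p q) =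
    cong₂ ℚ._+_ (trans (cong₂ ratio (≅-leaves p) (≅-leaves q)) (ratio-comm (leaves D) (leaves C)))
                (trans (cong₂ ℚ._+_ (≅-stairSum p) (≅-stairSum q)) (ℚ.+-comm (stairSum D) (stairSum C)))

  stairSum-node-< : ∀ {T₁ T₂ U₁ U₂} → leaves T₁ ≡ leaves U₁ → leaves T₂ ≡ leaves U₂ →
    stairSum T₁ ℚ.+ stairSum T₂ ℚ.< stairSum U₁ ℚ.+ stairSum U₂ → stairSum (node T₁ T₂) ℚ.< stairSum (node U₁ U₂)
  stairSum-node-< e₁ e₂ = ℚ.+-mono-≤-< (ℚ.≤-reflexive (cong₂ ratio e₁ e₂))

  stairSum-node-monoʳ-≤ : ∀ T U V → leaves U ≡ leaves V → stairSum U ℚ.≤ stairSum V →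
                          stairSum (node T U) ℚ.≤ stairSum (node T V)
  stairSum-node-monoʳ-≤ T U V e U≤V =
    ℚ.+-mono-≤ (ℚ.≤-reflexive (cong (ratio (leaves T)) e)) (ℚ.+-monoʳ-≤ (stairSum T) U≤V)

  infix 4 _⊑_
  _⊑_ : Tree → Tree → Set
  T ⊑ U = stairSum T ℚ.< stairSum U ⊎ T ≅ U

  ⊑⇒≤ : ∀ {T U} → T ⊑ U → stairSum T ℚ.≤ stairSum U
  ⊑⇒≤ (inj₁ T<U) = ℚ.<⇒≤ T<U
  ⊑⇒≤ (inj₂ T≅U) = ℚ.≤-reflexive (≅-stairSum T≅U)

  ⊑-trans : ∀ {T U V} → T ⊑ U → U ⊑ V → T ⊑ V
  ⊑-trans (inj₁ T<U) U⊑V        = inj₁ (ℚ.<-≤-trans T<U (⊑⇒≤ U⊑V))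
  ⊑-trans (inj₂ T≅U) (inj₁ U<V) = inj₁ (ℚ.≤-<-trans (⊑⇒≤ (inj₂ T≅U)) U<V)
  ⊑-trans (inj₂ T≅U) (inj₂ U≅V) = inj₂ (≅-trans T≅U U≅V)

  ⊑-node : ∀ {T₁ T₂ U₁ U₂} → leaves T₁ ≡ leaves U₁ → leaves T₂ ≡ leaves U₂ →
           T₁ ⊑ U₁ → T₂ ⊑ U₂ → node T₁ T₂ ⊑ node U₁ U₂
  ⊑-node _  _  (inj₂ p) (inj₂ q) = inj₂ (node≅ p q)
  ⊑-node {T₁} {T₂} {U₁} {U₂} e₁ e₂ (inj₁ p) q =
    inj₁ (stairSum-node-< {T₁} {T₂} {U₁} {U₂} e₁ e₂ (ℚ.+-mono-<-≤ p (⊑⇒≤ q)))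
  ⊑-node {T₁} {T₂} {U₁} {U₂} e₁ e₂ (inj₂ p) (inj₁ q) =
    inj₁ (stairSum-node-< {T₁} {T₂} {U₁} {U₂} e₁ e₂ (ℚ.+-mono-≤-< (⊑⇒≤ (inj₂ p)) q))

  ⊑-node-comm : ∀ {T U V} → node U T ⊑ V → node T U ⊑ V
  ⊑-node-comm = ⊑-trans (inj₂ (swap≅ ≅-refl ≅-refl))

  ℚ-ring : AlmostCommutativeRing 0ℓ 0ℓ
  ℚ-ring = fromCommutativeRing ℚ.+-*-commutativeRing (λ _ → nothing)

  <-by-gain : ∀ {x y g h Σ} → x ≡ g ℚ.+ Σ → y ≡ h ℚ.+ Σ → g ℚ.< h → x ℚ.< y
  <-by-gain {Σ = Σ} refl refl g<h = ℚ.+-monoˡ-< Σ g<h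

  stairSum-swap-< : ∀ A B C {a b c} → leaves A ≡ a → leaves B ≡ b → leaves C ≡ c →
    ratio a (b + c) ℚ.+ ratio b c ℚ.< ratio b (a + c) ℚ.+ ratio a c →
    stairSum (node A (node B C)) ℚ.< stairSum (node B (node A C))
  stairSum-swap-< A B C {a} {b} {c} refl refl refl =
    <-by-gain (lhs (ratio a (b + c)) (ratio b c) (stairSum A) (stairSum B) (stairSum C))
              (rhs (ratio b (a + c)) (ratio a c) (stairSum A) (stairSum B) (stairSum C))
    where
    lhs : ∀ x y p q r → x ℚ.+ (p ℚ.+ (y ℚ.+ (q ℚ.+ r))) ≡ (x ℚ.+ y) ℚ.+ (p ℚ.+ (q ℚ.+ r))
    lhs = solve-∀ ℚ-ring
    rhs : ∀ x y p q r → x ℚ.+ (q ℚ.+ (y ℚ.+ (p ℚ.+ r))) ≡ (x ℚ.+ y) ℚ.+ (p ℚ.+ (q ℚ.+ r))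
    rhs = solve-∀ ℚ-ring

  stairSum-assoc-< : ∀ A B C {a b c} → leaves A ≡ a → leaves B ≡ b → leaves C ≡ c →
    ratio a (b + c) ℚ.+ ratio b c ℚ.< ratio (a + b) c ℚ.+ ratio a b →
    stairSum (node A (node B C)) ℚ.< stairSum (node (node A B) C)
  stairSum-assoc-< A B C {a} {b} {c} refl refl refl =
    <-by-gain (lhs (ratio a (b + c)) (ratio b c) (stairSum A) (stairSum B) (stairSum C))
              (rhs (ratio (a + b) c) (ratio a b) (stairSum A) (stairSum B) (stairSum C))
    where
    lhs : ∀ x y p q r → x ℚ.+ (p ℚ.+ (y ℚ.+ (q ℚ.+ r))) ≡ (x ℚ.+ y) ℚ.+ (p ℚ.+ (q ℚ.+ r))
    lhs = solve-∀ ℚ-ring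
    rhs : ∀ x y p q r → x ℚ.+ ((y ℚ.+ (p ℚ.+ q)) ℚ.+ r) ≡ (x ℚ.+ y) ℚ.+ (p ℚ.+ (q ℚ.+ r))
    rhs = solve-∀ ℚ-ring

  stairSum-interchange-< : ∀ A B C D {a b c d} →
    leaves A ≡ a → leaves B ≡ b → leaves C ≡ c → leaves D ≡ d →
    ratio (a + b) (c + d) ℚ.+ (ratio a b ℚ.+ ratio c d) ℚ.< ratio (a + c) (b + d) ℚ.+ (ratio a c ℚ.+ ratio b d) →
    stairSum (node (node A B) (node C D)) ℚ.< stairSum (node (node A C) (node B D))
  stairSum-interchange-< A B C D {a} {b} {c} {d} refl refl refl refl =
    <-by-gain (lhs (ratio (a + b) (c + d)) (ratio a b) (ratio c d) (stairSum A) (stairSum B) (stairSum C) (stairSum D))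
              (rhs (ratio (a + c) (b + d)) (ratio a c) (ratio b d) (stairSum A) (stairSum B) (stairSum C) (stairSum D))
    where
    lhs : ∀ x y z p q r t → x ℚ.+ ((y ℚ.+ (p ℚ.+ q)) ℚ.+ (z ℚ.+ (r ℚ.+ t)))
                          ≡ (x ℚ.+ (y ℚ.+ z)) ℚ.+ (p ℚ.+ (q ℚ.+ (r ℚ.+ t)))
    lhs = solve-∀ ℚ-ring
    rhs : ∀ x y z p q r t → x ℚ.+ ((y ℚ.+ (p ℚ.+ r)) ℚ.+ (z ℚ.+ (q ℚ.+ t)))
                          ≡ (x ℚ.+ (y ℚ.+ z)) ℚ.+ (p ℚ.+ (q ℚ.+ (r ℚ.+ t)))
    rhs = solve-∀ ℚ-ring

  stairSum-exchange-< : ∀ A B C D E {a b c d e} →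
    leaves A ≡ a → leaves B ≡ b → leaves C ≡ c → leaves D ≡ d → leaves E ≡ e →
    ratio a (b + c) ℚ.+ ratio b c ℚ.+ ratio d e ℚ.< ratio (b + d) e ℚ.+ ratio b d ℚ.+ ratio a c →
    stairSum (node A C) ℚ.≤ stairSum (node D E) →
    stairSum (node A (node B C)) ℚ.< stairSum (node (node B D) E)
  stairSum-exchange-< A B C D E {a} {b} {c} {d} {e} refl refl refl refl refl gain AC≤DE = cancel (<-by-gain
      (lhs (ratio a (b + c)) (ratio b c) (ratio d e) (stairSum A) (stairSum B) (stairSum C) (stairSum D) (stairSum E))
      (rhs (ratio (b + d) e) (ratio b d) (ratio a c) (stairSum A) (stairSum B) (stairSum C) (stairSum D) (stairSum E))
      gain)
    where
    lhs : ∀ x y z p q r s t → x ℚ.+ (p ℚ.+ (y ℚ.+ (q ℚ.+ r))) ℚ.+ (z ℚ.+ (s ℚ.+ t))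
                            ≡ (x ℚ.+ y ℚ.+ z) ℚ.+ (p ℚ.+ (q ℚ.+ (r ℚ.+ (s ℚ.+ t))))
    lhs = solve-∀ ℚ-ring
    rhs : ∀ x y z p q r s t → x ℚ.+ ((y ℚ.+ (q ℚ.+ s)) ℚ.+ t) ℚ.+ (z ℚ.+ (p ℚ.+ r))
                            ≡ (x ℚ.+ y ℚ.+ z) ℚ.+ (p ℚ.+ (q ℚ.+ (r ℚ.+ (s ℚ.+ t))))
    rhs = solve-∀ ℚ-ring
    cancel : stairSum (node A (node B C)) ℚ.+ stairSum (node D E) ℚ.< stairSum (node (node B D) E) ℚ.+ stairSum (node A C) →
             stairSum (node A (node B C)) ℚ.< stairSum (node (node B D) E)
    cancel lt = ℚ.≰⇒> (λ Z≤X → ℚ.<-irrefl refl (ℚ.<-≤-trans lt (ℚ.+-mono-≤ Z≤X AC≤DE)))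

  -- Binary echelon trees

  n<m+m⇒⌊n/2⌋<m : ∀ {n m} → n < m + m → ⌊ n /2⌋ < m
  n<m+m⇒⌊n/2⌋<m {n} {m} n<2m = ≰⇒> (λ m≤⌊n/2⌋ → <⇒≱ n<2m (begin
    m + m             ≤⟨ +-mono-≤ m≤⌊n/2⌋ (≤-trans m≤⌊n/2⌋ (⌊n/2⌋≤⌈n/2⌉ n)) ⟩
    ⌊ n /2⌋ + ⌈ n /2⌉ ≡⟨ ⌊n/2⌋+⌈n/2⌉≡n n ⟩
    n                 ∎))
    where open ≤-Reasoning

  2^[1+h]≡2^h+2^h : ∀ h → 2 ^ suc h ≡ 2 ^ h + 2 ^ h
  2^[1+h]≡2^h+2^h h = cong (_+_ (2 ^ h)) (+-identityʳ (2 ^ h))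

  x<2^[1+h]⇒⌊log₂x⌋≤h : ∀ h {x} → x < 2 ^ suc h → ⌊log₂ x ⌋ ≤ h
  x<2^[1+h]⇒⌊log₂x⌋≤h zero    {zero}        _              = z≤n
  x<2^[1+h]⇒⌊log₂x⌋≤h zero    {suc zero}    _              = z≤n
  x<2^[1+h]⇒⌊log₂x⌋≤h zero    {suc (suc _)} (s≤s (s≤s ()))
  x<2^[1+h]⇒⌊log₂x⌋≤h (suc h) {x} x<2^[2+h] = m∸1≤n⇒m≤1+n (subst (_≤ h) (⌊log₂⌊n/2⌋⌋≡⌊log₂n⌋∸1 x)
    (x<2^[1+h]⇒⌊log₂x⌋≤h h (n<m+m⇒⌊n/2⌋<m (subst (x <_) (2^[1+h]≡2^h+2^h (suc h)) x<2^[2+h]))))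
    where
    m∸1≤n⇒m≤1+n : ∀ {m n} → m ∸ 1 ≤ n → m ≤ suc n
    m∸1≤n⇒m≤1+n {zero}  _   = z≤n
    m∸1≤n⇒m≤1+n {suc m} m≤n = s≤s m≤n

  2^h≤x<2^[1+h]⇒⌊log₂x⌋≡h : ∀ {h x} → 2 ^ h ≤ x → x < 2 ^ suc h → ⌊log₂ x ⌋ ≡ h
  2^h≤x<2^[1+h]⇒⌊log₂x⌋≡h {h} lo hi =
    ≤-antisym (x<2^[1+h]⇒⌊log₂x⌋≤h h hi) (subst (_≤ _) (⌊log₂[2^n]⌋≡n h) (⌊log₂⌋-mono-≤ lo))

  1+n∸2^k≤n : ∀ n k → suc n ∸ 2 ^ k ≤ n
  1+n∸2^k≤n n k = ∸-monoʳ-≤ (suc n) (m^n>0 2 k)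

  beFuel-irrelevant : ∀ {f g n} → n ≤ f → n ≤ g → beFuel f n ≡ beFuel g n
  beFuel-irrelevant {zero}  {zero}  z≤n _   = refl
  beFuel-irrelevant {zero}  {suc g} z≤n _   = refl
  beFuel-irrelevant {suc f} {zero}  _   z≤n = refl
  beFuel-irrelevant {suc f} {suc g} {zero}        _ _ = refl
  beFuel-irrelevant {suc f} {suc g} {suc zero}    _ _ = refl
  beFuel-irrelevant {suc f} {suc g} {suc (suc m)} (s≤s m<f) (s≤s m<g) =
    cong (node (fb ⌊log₂ suc m ⌋)) (beFuel-irrelevant (≤-trans rest≤m m<f) (≤-trans rest≤m m<g))
    where
    rest≤m : suc (suc m) ∸ 2 ^ ⌊log₂ suc m ⌋ ≤ suc m
    rest≤m = 1+n∸2^k≤n (suc m) ⌊log₂ suc m ⌋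

  BE-unfold : ∀ {n} → 2 ≤ n → BE n ≡ node (fb ⌊log₂ (n ∸ 1) ⌋) (BE (n ∸ 2 ^ ⌊log₂ (n ∸ 1) ⌋))
  BE-unfold {suc zero}    (s≤s ())
  BE-unfold {suc (suc m)} _ =
    cong (node (fb ⌊log₂ suc m ⌋)) (beFuel-irrelevant (1+n∸2^k≤n (suc m) ⌊log₂ suc m ⌋) ≤-refl)

  BE-split : ∀ h {r} → 0 < r → r ≤ 2 ^ h → BE (2 ^ h + r) ≡ node (fb h) (BE r)
  BE-split h {suc r} _ r<2^h = begin
    BE (2 ^ h + suc r)                          ≡⟨ BE-unfold (+-mono-≤ (m^n>0 2 h) (s≤s z≤n)) ⟩
    node (fb k) (BE (2 ^ h + suc r ∸ 2 ^ k))    ≡⟨ cong (λ j → node (fb j) (BE (2 ^ h + suc r ∸ 2 ^ j))) k≡h ⟩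
    node (fb h) (BE (2 ^ h + suc r ∸ 2 ^ h))    ≡⟨ cong (node (fb h) ∘ BE) (m+n∸m≡n (2 ^ h) (suc r)) ⟩
    node (fb h) (BE (suc r))                    ∎
    where
    open ≡-Reasoning
    k = ⌊log₂ (2 ^ h + suc r ∸ 1) ⌋
    k≡h : k ≡ h
    k≡h = trans (cong ⌊log₂_⌋ (+-∸-assoc (2 ^ h) (s≤s z≤n)))
                (2^h≤x<2^[1+h]⇒⌊log₂x⌋≡h (m≤m+n (2 ^ h) r)
                  (subst (2 ^ h + r <_) (sym (2^[1+h]≡2^h+2^h h)) (+-monoʳ-< (2 ^ h) r<2^h)))

  BE-pow : ∀ h → BE (2 ^ h) ≡ fb h
  BE-pow zero    = refl
  BE-pow (suc h) = begin
    BE (2 ^ suc h)           ≡⟨ cong BE (2^[1+h]≡2^h+2^h h) ⟩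
    BE (2 ^ h + 2 ^ h)       ≡⟨ BE-split h (m^n>0 2 h) ≤-refl ⟩
    node (fb h) (BE (2 ^ h)) ≡⟨ cong (node (fb h)) (BE-pow h) ⟩
    node (fb h) (fb h)       ∎
    where open ≡-Reasoning

  BE-split-double : ∀ h {r} → 0 < r → r ≤ 2 ^ h + 2 ^ h →
                    BE (2 ^ h + 2 ^ h + r) ≡ node (node (fb h) (fb h)) (BE r)
  BE-split-double h {r} 0<r r≤2^[1+h] =
    subst (λ m → BE (m + r) ≡ node (fb (suc h)) (BE r)) (2^[1+h]≡2^h+2^h h)
          (BE-split (suc h) 0<r (subst (r ≤_) (sym (2^[1+h]≡2^h+2^h h)) r≤2^[1+h]))

  data Leading : ℕ → Set where
    power : ∀ h → Leading (2 ^ h)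
    above : ∀ h {s} → 0 < s → s < 2 ^ h → Leading (2 ^ h + s)

  leading-suc : ∀ {n} → Leading n → Leading (suc n)
  leading-suc (power zero)    = power 1
  leading-suc (power (suc h)) =
    subst Leading (+-comm (2 ^ suc h) 1) (above (suc h) (s≤s z≤n) (*-monoʳ-≤ 2 (m^n>0 2 h)))
  leading-suc (above h {s} 0<s s<2^h) with m≤n⇒m<n∨m≡n s<2^h
  ... | inj₁ 1+s<2^h = subst Leading (+-suc (2 ^ h) s) (above h (s≤s z≤n) 1+s<2^h)
  ... | inj₂ 1+s≡2^h =
    subst Leading (trans (2^[1+h]≡2^h+2^h h) (trans (cong (_+_ (2 ^ h)) (sym 1+s≡2^h)) (+-suc (2 ^ h) s))) (power (suc h))

  leading : ∀ {n} → 0 < n → Leading n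
  leading {suc n} _ = go n
    where
    go : ∀ n → Leading (suc n)
    go zero    = power 0
    go (suc n) = leading-suc (go n)

  leaves-fb : ∀ h → leaves (fb h) ≡ 2 ^ h
  leaves-fb zero    = refl
  leaves-fb (suc h) = trans (cong₂ _+_ (leaves-fb h) (leaves-fb h)) (sym (2^[1+h]≡2^h+2^h h))

  leaves-BE : ∀ {n} → 0 < n → leaves (BE n) ≡ n
  leaves-BE = go (<-wellFounded _)
    where
    go : ∀ {n} → Acc _<_ n → 0 < n → leaves (BE n) ≡ n
    go (acc rec) 0<n with leading 0<n
    ... | power h               = trans (cong leaves (BE-pow h)) (leaves-fb h)
    ... | above h {s} 0<s s<2^h =
      trans (cong leaves (BE-split h 0<s (<⇒≤ s<2^h))) (cong₂ _+_ (leaves-fb h) (go (rec (m<n+m s (m^n>0 2 h))) 0<s))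

  leaves-join : ∀ {a b} → 0 < a → 0 < b → leaves (node (BE a) (BE b)) ≡ leaves (BE (a + b))
  leaves-join 0<a 0<b =
    trans (cong₂ _+_ (leaves-BE 0<a) (leaves-BE 0<b)) (sym (leaves-BE (<-≤-trans 0<a (m≤m+n _ _))))

  -- Joins of binary echelon trees

  join-≅-power : ∀ h {a} → 0 < a → a ≤ 2 ^ h → node (BE a) (BE (2 ^ h)) ≅ BE (a + 2 ^ h)
  join-≅-power h {a} 0<a a≤2^h =
    subst (node (BE a) (BE (2 ^ h)) ≅_) (trans (sym (BE-split h 0<a a≤2^h)) (cong BE (+-comm (2 ^ h) a)))
          (swap≅ ≅-refl (≅-reflexive (BE-pow h)))

  join-<-swap : ∀ h {a s} → 0 < a → 0 < s → a + s ≤ 2 ^ h →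
    stairSum (node (BE a) (BE s)) ℚ.≤ stairSum (BE (a + s)) →
    stairSum (node (BE a) (BE (2 ^ h + s))) ℚ.< stairSum (BE (a + (2 ^ h + s)))
  join-<-swap h {a} {s} 0<a 0<s a+s≤2^h ih = begin-strict
    stairSum (node (BE a) (BE (2 ^ h + s)))
      ≡⟨ cong (stairSum ∘ node (BE a)) (BE-split h 0<s (≤-trans (m≤n+m s a) a+s≤2^h)) ⟩
    stairSum (node (BE a) (node (fb h) (BE s)))
      <⟨ stairSum-swap-< (BE a) (fb h) (BE s) (leaves-BE 0<a) (leaves-fb h) (leaves-BE 0<s) (ratio-swap-< 0<a 0<s a+s≤2^h) ⟩
    stairSum (node (fb h) (node (BE a) (BE s)))
      ≤⟨ stairSum-node-monoʳ-≤ (fb h) (node (BE a) (BE s)) (BE (a + s)) (leaves-join 0<a 0<s) ih ⟩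
    stairSum (node (fb h) (BE (a + s)))
      ≡⟨ cong stairSum (sym (BE-split h (<-≤-trans 0<a (m≤m+n a s)) a+s≤2^h)) ⟩
    stairSum (BE (2 ^ h + (a + s)))
      ≡⟨ cong (stairSum ∘ BE) (ℕ+.x∙yz≈y∙xz (2 ^ h) a s) ⟩
    stairSum (BE (a + (2 ^ h + s))) ∎
    where open ℚ.≤-Reasoning

  join-<-assoc : ∀ h {s} → 0 < s → s < 2 ^ h →
    stairSum (node (BE (2 ^ h)) (BE (2 ^ h + s))) ℚ.< stairSum (BE (2 ^ h + (2 ^ h + s)))
  join-<-assoc h {s} 0<s s<2^h = begin-strict
    stairSum (node (BE (2 ^ h)) (BE (2 ^ h + s)))
      ≡⟨ cong₂ (λ T U → stairSum (node T U)) (BE-pow h) (BE-split h 0<s (<⇒≤ s<2^h)) ⟩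
    stairSum (node (fb h) (node (fb h) (BE s)))
      <⟨ stairSum-assoc-< (fb h) (fb h) (BE s) (leaves-fb h) (leaves-fb h) (leaves-BE 0<s) (ratio-assoc-< 0<s s<2^h) ⟩
    stairSum (node (node (fb h) (fb h)) (BE s))
      ≡⟨ cong stairSum (sym (BE-split-double h 0<s (≤-trans (<⇒≤ s<2^h) (m≤n+m (2 ^ h) (2 ^ h))))) ⟩
    stairSum (BE (2 ^ h + 2 ^ h + s))
      ≡⟨ cong (stairSum ∘ BE) (+-assoc (2 ^ h) (2 ^ h) s) ⟩
    stairSum (BE (2 ^ h + (2 ^ h + s))) ∎
    where open ℚ.≤-Reasoning

  join-<-interchange : ∀ h {t s} → 0 < t → t ≤ s → s < 2 ^ h →
    stairSum (node (BE t) (BE s)) ℚ.≤ stairSum (BE (t + s)) →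
    stairSum (node (BE (2 ^ h + t)) (BE (2 ^ h + s))) ℚ.< stairSum (BE (2 ^ h + t + (2 ^ h + s)))
  join-<-interchange h {t} {s} 0<t t≤s s<2^h ih = begin-strict
    stairSum (node (BE (2 ^ h + t)) (BE (2 ^ h + s)))
      ≡⟨ cong₂ (λ T U → stairSum (node T U)) (BE-split h 0<t t≤2^h) (BE-split h 0<s s≤2^h) ⟩
    stairSum (node (node (fb h) (BE t)) (node (fb h) (BE s)))
      <⟨ stairSum-interchange-< (fb h) (BE t) (fb h) (BE s) (leaves-fb h) (leaves-BE 0<t) (leaves-fb h) (leaves-BE 0<s)
                                (ratio-interchange-< 0<t t≤s s<2^h) ⟩
    stairSum (node (node (fb h) (fb h)) (node (BE t) (BE s)))
      ≤⟨ stairSum-node-monoʳ-≤ (node (fb h) (fb h)) (node (BE t) (BE s)) (BE (t + s)) (leaves-join 0<t 0<s) ih ⟩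
    stairSum (node (node (fb h) (fb h)) (BE (t + s)))
      ≡⟨ cong stairSum (sym (BE-split-double h (<-≤-trans 0<t (m≤m+n t s)) (+-mono-≤ t≤2^h s≤2^h))) ⟩
    stairSum (BE (2 ^ h + 2 ^ h + (t + s)))
      ≡⟨ cong (stairSum ∘ BE) (ℕ+.interchange (2 ^ h) (2 ^ h) t s) ⟩
    stairSum (BE (2 ^ h + t + (2 ^ h + s))) ∎
    where
    open ℚ.≤-Reasoning
    0<s : 0 < s
    0<s = <-≤-trans 0<t t≤s
    s≤2^h : s ≤ 2 ^ h
    s≤2^h = <⇒≤ s<2^h
    t≤2^h : t ≤ 2 ^ h
    t≤2^h = ≤-trans t≤s s≤2^h

  -- The swap alone to node (fb h) (node (BE a) (BE s)) can lower the stairs sum here (for a ≤ s with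
  -- s close to 2^h), so it is combined with the rotation of node (fb h) (BE (2^h + r)) into one step.
  join-<-exchange : ∀ h {a s r} → 0 < a → a < 2 ^ h → 0 < s → s < 2 ^ h → 0 < r → a + s ≡ 2 ^ h + r →
    stairSum (node (BE a) (BE s)) ℚ.≤ stairSum (BE (a + s)) →
    stairSum (node (BE a) (BE (2 ^ h + s))) ℚ.< stairSum (BE (a + (2 ^ h + s)))
  join-<-exchange h {a} {s} {r} 0<a a<2^h 0<s s<2^h 0<r a+s≡2^h+r ih = begin-strict
    stairSum (node (BE a) (BE (2 ^ h + s)))
      ≡⟨ cong (stairSum ∘ node (BE a)) (BE-split h 0<s (<⇒≤ s<2^h)) ⟩
    stairSum (node (BE a) (node (fb h) (BE s)))
      <⟨ stairSum-exchange-< (BE a) (fb h) (BE s) (fb h) (BE r)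
           (leaves-BE 0<a) (leaves-fb h) (leaves-BE 0<s) (leaves-fb h) (leaves-BE 0<r)
           (ratio-exchange-< 0<a a<2^h s<2^h a+s≡2^h+r) ih′ ⟩
    stairSum (node (node (fb h) (fb h)) (BE r))
      ≡⟨ cong stairSum (sym (BE-split-double h 0<r (≤-trans r≤2^h (m≤m+n (2 ^ h) (2 ^ h))))) ⟩
    stairSum (BE (2 ^ h + 2 ^ h + r))
      ≡⟨ cong (stairSum ∘ BE) size ⟩
    stairSum (BE (a + (2 ^ h + s))) ∎
    where
    open ℚ.≤-Reasoning
    r≤2^h : r ≤ 2 ^ h
    r≤2^h = <⇒≤ (+-cancelˡ-< (2 ^ h) r (2 ^ h) (subst (_< 2 ^ h + 2 ^ h) a+s≡2^h+r (+-mono-< a<2^h s<2^h)))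
    ih′ : stairSum (node (BE a) (BE s)) ℚ.≤ stairSum (node (fb h) (BE r))
    ih′ = subst (stairSum (node (BE a) (BE s)) ℚ.≤_) (cong stairSum (trans (cong BE a+s≡2^h+r) (BE-split h 0<r r≤2^h))) ih
    size : 2 ^ h + 2 ^ h + r ≡ a + (2 ^ h + s)
    size = trans (+-assoc (2 ^ h) (2 ^ h) r) (trans (cong (_+_ (2 ^ h)) (sym a+s≡2^h+r)) (ℕ+.x∙yz≈y∙xz (2 ^ h) a s))

  -- With b = 2^h + s and 0 < s, the largest power of two below a + b is 2^h when a + s ≤ 2^h and
  -- 2^(h + 1) otherwise.
  join-ordered : ∀ {a b} →
    (∀ {a′ b′} → a′ + b′ < a + b → 0 < a′ → 0 < b′ → node (BE a′) (BE b′) ⊑ BE (a′ + b′)) →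
    0 < a → a ≤ b → node (BE a) (BE b) ⊑ BE (a + b)
  join-ordered {a} ih 0<a a≤b with leading (<-≤-trans 0<a a≤b)
  ... | power h = inj₂ (join-≅-power h 0<a a≤b)
  ... | above h {s} 0<s s<2^h with a + s ≤? 2 ^ h
  ...   | yes a+s≤2^h = inj₁ (join-<-swap h 0<a 0<s a+s≤2^h (⊑⇒≤ (ih (+-monoʳ-< a (m<n+m s (m^n>0 2 h))) 0<a 0<s)))
  ...   | no  a+s≰2^h with <-cmp a (2 ^ h)
  ...     | tri≈ _ refl _ = inj₁ (join-<-assoc h 0<s s<2^h)
  ...     | tri< a<2^h _ _ with m≤n⇒∃[o]m+o≡n (≰⇒> a+s≰2^h)
  ...       | r , 1+2^h+r≡a+s =
    inj₁ (join-<-exchange h 0<a a<2^h 0<s s<2^h (s≤s z≤n) (trans (sym 1+2^h+r≡a+s) (sym (+-suc (2 ^ h) r)))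
           (⊑⇒≤ (ih (+-monoʳ-< a (m<n+m s (m^n>0 2 h))) 0<a 0<s)))
  join-ordered {a} ih 0<a a≤b | above h {s} 0<s s<2^h | no _ | tri> _ _ 2^h<a with m≤n⇒∃[o]m+o≡n (<⇒≤ 2^h<a)
  ... | t , refl = inj₁ (join-<-interchange h 0<t (+-cancelˡ-≤ (2 ^ h) t s a≤b) s<2^h
                           (⊑⇒≤ (ih (+-mono-< (m<n+m t (m^n>0 2 h)) (m<n+m s (m^n>0 2 h))) 0<t 0<s)))
    where
    0<t : 0 < t
    0<t = +-cancelˡ-< (2 ^ h) 0 t (subst (_< 2 ^ h + t) (sym (+-identityʳ (2 ^ h))) 2^h<a)

  join-⊑ : ∀ {a b} → 0 < a → 0 < b → node (BE a) (BE b) ⊑ BE (a + b)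
  join-⊑ = go (<-wellFounded _)
    where
    go : ∀ {a b} → Acc _<_ (a + b) → 0 < a → 0 < b → node (BE a) (BE b) ⊑ BE (a + b)
    go {a} {b} (acc rec) 0<a 0<b with ≤-total a b
    ... | inj₁ a≤b = join-ordered (λ lt → go (rec lt)) 0<a a≤b
    ... | inj₂ b≤a = ⊑-node-comm (subst (λ n → node (BE b) (BE a) ⊑ BE n) (+-comm b a)
                       (join-ordered (λ {a′} {b′} lt → go (rec (subst (a′ + b′ <_) (+-comm b a) lt))) 0<b b≤a))

  ⊑-BE : ∀ T → T ⊑ BE (leaves T)
  ⊑-BE leaf       = inj₂ leaf≅
  ⊑-BE (node T U) =
    ⊑-trans (⊑-node (sym (leaves-BE (leaves-pos T))) (sym (leaves-BE (leaves-pos U))) (⊑-BE T) (⊑-BE U))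
            (join-⊑ (leaves-pos T) (leaves-pos U))

  st2-scaled : ∀ T m → leaves T ≡ suc (suc m) → st2 T ≡ (+ 1 ℚ./ suc m) ℚ.* stairSum T
  st2-scaled T m e with leaves T
  st2-scaled T m refl | .(suc (suc m)) = refl

  stairSum-≤⇔st2-≤ : ∀ T U {m} → leaves T ≡ suc (suc m) → leaves U ≡ suc (suc m) →
                     stairSum T ℚ.≤ stairSum U ⇔ st2 T ℚ.≤ st2 U
  stairSum-≤⇔st2-≤ T U {m} eT eU = mk⇔
    (λ T≤U → subst₂ ℚ._≤_ (sym (st2-scaled T m eT)) (sym (st2-scaled U m eU)) (ℚ.*-monoˡ-≤-nonNeg c {{ℚ.pos⇒nonNeg c}} T≤U))
    (λ T≤U → ℚ.*-cancelˡ-≤-pos c (subst₂ ℚ._≤_ (st2-scaled T m eT) (st2-scaled U m eU) T≤U))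
    where
    c = + 1 ℚ./ suc m
    instance
      c-pos : ℚ.Positive c
      c-pos = ℚ.normalize-pos 1 (suc m)

  ≅BE⇒st2-maximal : ∀ {n T} → 0 < n → leaves T ≡ n → T ≅ BE n → ∀ T′ → leaves T′ ≡ n → st2 T′ ℚ.≤ st2 T
  ≅BE⇒st2-maximal {suc zero} {T} _ eT _ T′ eT′ with leaves-one {T} eT | leaves-one {T′} eT′
  ... | refl | refl = ℚ.≤-refl
  ≅BE⇒st2-maximal {suc (suc m)} {T} _ eT T≅BE T′ eT′ = Equivalence.to (stairSum-≤⇔st2-≤ T′ T eT′ eT) (begin
    stairSum T′                 ≤⟨ ⊑⇒≤ (⊑-BE T′) ⟩
    stairSum (BE (leaves T′))   ≡⟨ cong (stairSum ∘ BE) eT′ ⟩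
    stairSum (BE (suc (suc m))) ≡⟨ sym (≅-stairSum T≅BE) ⟩
    stairSum T                  ∎)
    where open ℚ.≤-Reasoning

  st2-maximal⇒≅BE : ∀ {n T} → 0 < n → leaves T ≡ n → (∀ T′ → leaves T′ ≡ n → st2 T′ ℚ.≤ st2 T) → T ≅ BE n
  st2-maximal⇒≅BE {suc zero} {T} _ eT _ with leaves-one {T} eT
  ... | refl = leaf≅
  st2-maximal⇒≅BE {suc (suc m)} {T} 0<n eT maximal with subst (λ n → T ⊑ BE n) eT (⊑-BE T)
  ... | inj₂ T≅BE = T≅BE
  ... | inj₁ T<BE = contradiction (ℚ.<-≤-trans T<BE BE≤T) (ℚ.<-irrefl refl)
    where
    BE≤T : stairSum (BE (suc (suc m))) ℚ.≤ stairSum T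
    BE≤T = Equivalence.from (stairSum-≤⇔st2-≤ (BE (suc (suc m))) T (leaves-BE 0<n) eT)
                            (maximal (BE (suc (suc m))) (leaves-BE 0<n))

open import Data.Nat using (ℕ; _≥_)
open import Data.Rational using (_≤_)
open import Relation.Binary.PropositionalEquality using (_≡_)
open import Data.Product using (_×_; _,_)
open import Function.Bundles using (_⇔_; mk⇔)
open Echelon using (leaves-BE; st2-maximal⇒≅BE; ≅BE⇒st2-maximal)

theorem4p1 : (n : ℕ) → n ≥ 1 →
    leaves (BE n) ≡ n ×
    ((T : Tree) → leaves T ≡ n →
      (((T′ : Tree) → leaves T′ ≡ n → st2 T′ ≤ st2 T) ⇔ (T ≅ BE n)))
theorem4p1 n n≥1 = leaves-BE n≥1 , λ T leaves-T → mk⇔ (st2-maximal⇒≅BE n≥1 leaves-T) (≅BE⇒st2-maximal n≥1 leaves-T)
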